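{- Let $b\ge 2$ and $k\ge 1$ be integers, set $B=b^k$, let $m\ge 1$ with $\gcd(m,b)=1$, and let $0\le r<m$. Let $s\ge 1$ be an integer with $s\equiv r\pmod m$ and $\gcd(s,b)=1$. Define $\omega_s=\operatorname{ord}_{ms}(B)$ (the multiplicative order of $B$ modulo $ms$, which is $1$ if $ms=1$) and \[ n_s=\sum_{j=0}^{s-1} B^{j\omega_s}. \] Then: (1) $n_s\equiv r\pmod m$; (2) $\mathsf{s}_B(n_s)=\mathsf{s}_b(n_s)=s$; (3) $s\mid n_s$. In particular, $n_s$ is simultaneously $b$-Niven and $B$-Niven.
   Context: For an integer base $g\ge 2$ and a positive integer $c$ with base-$g$ expansion $c=\sum_{i=0}^{L} d_i g^i$, $d_i\in\{0,1,\dots,g-1\}$, $d_L\neq 0$, the base-$g$ digit sum is $\mathsf{s}_g(c)=\sum_{i=0}^{L} d_i$. An integer $c$ is $g$-Niven if $\mathsf{s}_g(c)\mid c$. For $\gcd(a,N)=1$, $\operatorname{ord}_N(a)$ is the least $\omega\ge 1$ with $a^\omega\equiv 1\pmod N$. -}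

module Defs where

open import Data.Nat using (ℕ; zero; suc; _+_; _*_; _^_; _≤_; _<_; NonZero)
open import Data.Nat.DivMod using (_/_; _%_)
open import Data.Nat.Divisibility using (_∣_)
open import Data.Product using (_×_)
open import Relation.Binary.PropositionalEquality using (_≡_)

-- Base-g digit sum with fuel: digitSumAux g f c sums the base-g digits of c,
-- provided the fuel f ≥ c (each step c ↦ c / g strictly decreases c > 0 when g ≥ 2).
digitSumAux : (g : ℕ) → .{{_ : NonZero g}} → ℕ → ℕ → ℕ
digitSumAux g zero    c = 0
digitSumAux g (suc f) c = c % g + digitSumAux g f (c / g)

digitSum : (g : ℕ) → .{{_ : NonZero g}} → ℕ → ℕ
digitSum g c = digitSumAux g c c

Niven : (g : ℕ) → .{{_ : NonZero g}} → ℕ → Set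
Niven g c = digitSum g c ∣ c

IsOrder : (N a ω : ℕ) → .{{_ : NonZero N}} → Set
IsOrder N a ω =
  1 ≤ ω × (a ^ ω) % N ≡ 1 % N × (∀ w → 1 ≤ w → (a ^ w) % N ≡ 1 % N → ω ≤ w)

sumRange : ℕ → (ℕ → ℕ) → ℕ
sumRange zero    f = 0
sumRange (suc n) f = sumRange n f + f n

module Submission where

open import Defs
open import Data.Nat using (ℕ; zero; suc; >-nonZero; _+_; _*_; _^_; _≤_; _<_; NonZero; z≤n; s≤s)
open import Data.Nat.DivMod
open import Data.Nat.Divisibility using (_∣_; m%n≡0⇒n∣m; m∣m*n; n∣m*n)
open import Data.Nat.GCD using (gcd)
open import Data.Nat.Properties
open import Data.Product using (_×_; _,_)
open import Relation.Binary.PropositionalEquality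

-- In base g, the number Σ_{j<s} g^(j e) with e ≥ 1 is written with s isolated digits 1,
-- so its digit sum is s; since B = b^k it is also of this shape in base b, with spacing k ω.
-- Modulo m s every term B^(j ω) is 1, so the number is ≡ s (mod m s), which yields both
-- the residue r modulo m and divisibility by s. The coprimality hypotheses only serve to
-- make the order ω exist, so the proof does not use them.

digitSumAux-zero : ∀ g .{{_ : NonZero g}} f → digitSumAux g f 0 ≡ 0
digitSumAux-zero g zero = refl
digitSumAux-zero g@(suc _) (suc f) = digitSumAux-zero g f

/-fuel : ∀ g .{{_ : NonZero g}} → 2 ≤ g → ∀ c f → c ≤ suc f → c / g ≤ f
/-fuel g@(suc _) _ zero f _ = z≤n
/-fuel g 2≤g (suc c) f c≤1+f = <⇒≤pred (≤-trans (m/n<m (suc c) g 2≤g) c≤1+f)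

digitSumAux-fuel-irrelevant : ∀ g .{{_ : NonZero g}} → 2 ≤ g → ∀ c f f′ → c ≤ f → c ≤ f′ →
                              digitSumAux g f c ≡ digitSumAux g f′ c
digitSumAux-fuel-irrelevant g _ c zero zero _ _ = refl
digitSumAux-fuel-irrelevant g _ .0 zero (suc f′) z≤n _ = sym (digitSumAux-zero g (suc f′))
digitSumAux-fuel-irrelevant g _ .0 (suc f) zero _ z≤n = digitSumAux-zero g (suc f)
digitSumAux-fuel-irrelevant g 2≤g c (suc f) (suc f′) c≤1+f c≤1+f′ =
  cong (c % g +_) (digitSumAux-fuel-irrelevant g 2≤g (c / g) f f′
                     (/-fuel g 2≤g c f c≤1+f) (/-fuel g 2≤g c f′ c≤1+f′))

digitSum-unfold : ∀ g .{{_ : NonZero g}} → 2 ≤ g → ∀ c → digitSum g c ≡ c % g + digitSum g (c / g)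
digitSum-unfold g 2≤g c =
  trans (digitSumAux-fuel-irrelevant g 2≤g c c (suc c) ≤-refl (n≤1+n c))
        (cong (c % g +_) (digitSumAux-fuel-irrelevant g 2≤g (c / g) c (c / g) (m/n≤m c g) ≤-refl))

digitSum-digit+base* : ∀ g .{{_ : NonZero g}} → 2 ≤ g → ∀ d c → d < g →
                       digitSum g (d + g * c) ≡ d + digitSum g c
digitSum-digit+base* g 2≤g d c d<g =
  trans (digitSum-unfold g 2≤g (d + g * c)) (cong₂ _+_ lastDigit (cong (digitSum g) quotient))
  where
  lastDigit : (d + g * c) % g ≡ d
  lastDigit = trans (%-remove-+ʳ d (m∣m*n c)) (m<n⇒m%n≡m d<g)
  quotient : (d + g * c) / g ≡ c
  quotient = trans (+-distrib-/-∣ʳ d (m∣m*n c))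
                   (cong₂ _+_ (m<n⇒m/n≡0 d<g) (trans (cong (_/ g) (*-comm g c)) (m*n/n≡m c g)))

digitSum-base^* : ∀ g .{{_ : NonZero g}} → 2 ≤ g → ∀ e c → digitSum g (g ^ e * c) ≡ digitSum g c
digitSum-base^* g 2≤g zero c = cong (digitSum g) (+-identityʳ c)
digitSum-base^* g 2≤g (suc e) c = begin
  digitSum g (g * g ^ e * c)   ≡⟨ cong (digitSum g) (*-assoc g (g ^ e) c) ⟩
  digitSum g (g * (g ^ e * c)) ≡⟨ digitSum-digit+base* g 2≤g 0 (g ^ e * c) (≤-trans (s≤s z≤n) 2≤g) ⟩
  digitSum g (g ^ e * c)       ≡⟨ digitSum-base^* g 2≤g e c ⟩
  digitSum g c                 ∎
  where open ≡-Reasoning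

sumRange-cong : ∀ s {f h} → (∀ j → f j ≡ h j) → sumRange s f ≡ sumRange s h
sumRange-cong zero    f≗h = refl
sumRange-cong (suc s) f≗h = cong₂ _+_ (sumRange-cong s f≗h) (f≗h s)

sumRange-suc : ∀ s f → sumRange (suc s) f ≡ f 0 + sumRange s (λ j → f (suc j))
sumRange-suc zero    f = sym (+-identityʳ (f 0))
sumRange-suc (suc s) f = trans (cong (_+ f (suc s)) (sumRange-suc s f)) (+-assoc (f 0) _ _)

sumRange-*ˡ : ∀ s c f → sumRange s (λ j → c * f j) ≡ c * sumRange s f
sumRange-*ˡ zero    c f = sym (*-zeroʳ c)
sumRange-*ˡ (suc s) c f = trans (cong (_+ c * f s) (sumRange-*ˡ s c f)) (sym (*-distribˡ-+ c _ _))

sumRange-%-ones : ∀ M .{{_ : NonZero M}} f → (∀ j → f j % M ≡ 1 % M) →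
                  ∀ s → sumRange s f % M ≡ s % M
sumRange-%-ones M f f≡1 zero    = refl
sumRange-%-ones M f f≡1 (suc s) = begin
  (sumRange s f + f s) % M             ≡⟨ %-distribˡ-+ (sumRange s f) (f s) M ⟩
  (sumRange s f % M + f s % M) % M     ≡⟨ cong₂ (λ x y → (x + y) % M) (sumRange-%-ones M f f≡1 s) (f≡1 s) ⟩
  (s % M + 1 % M) % M                  ≡⟨ sym (%-distribˡ-+ s 1 M) ⟩
  (s + 1) % M                          ≡⟨ cong (_% M) (+-comm s 1) ⟩
  suc s % M                            ∎
  where open ≡-Reasoning

^-%-one : ∀ M .{{_ : NonZero M}} x → x % M ≡ 1 % M → ∀ j → x ^ j % M ≡ 1 % M
^-%-one M x x≡1 zero    = refl
^-%-one M x x≡1 (suc j) = begin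
  (x * x ^ j) % M               ≡⟨ %-distribˡ-* x (x ^ j) M ⟩
  (x % M * (x ^ j % M)) % M     ≡⟨ cong₂ (λ u v → (u * v) % M) x≡1 (^-%-one M x x≡1 j) ⟩
  (1 % M * (1 % M)) % M         ≡⟨ sym (%-distribˡ-* 1 1 M) ⟩
  1 % M                         ∎
  where open ≡-Reasoning

%-cong-∣ : ∀ d M .{{_ : NonZero d}} .{{_ : NonZero M}} → d ∣ M →
           ∀ x y → x % M ≡ y % M → x % d ≡ y % d
%-cong-∣ d M d∣M x y x≡y = begin
  x % d       ≡⟨ sym (m∣n⇒o%n%m≡o%m d M x d∣M) ⟩
  x % M % d   ≡⟨ cong (_% d) x≡y ⟩
  y % M % d   ≡⟨ m∣n⇒o%n%m≡o%m d M y d∣M ⟩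
  y % d       ∎
  where open ≡-Reasoning

spacedRepunit : ℕ → ℕ → ℕ → ℕ
spacedRepunit g e s = sumRange s (λ j → g ^ (j * e))

spacedRepunit-suc : ∀ g e s → spacedRepunit g e (suc s) ≡ 1 + g ^ e * spacedRepunit g e s
spacedRepunit-suc g e s =
  trans (sumRange-suc s (λ j → g ^ (j * e)))
        (cong (1 +_) (trans (sumRange-cong s (λ j → ^-distribˡ-+-* g e (j * e)))
                            (sumRange-*ˡ s (g ^ e) (λ j → g ^ (j * e)))))

digitSum-spacedRepunit : ∀ g .{{_ : NonZero g}} → 2 ≤ g → ∀ e → 1 ≤ e → ∀ s →
                         digitSum g (spacedRepunit g e s) ≡ s
digitSum-spacedRepunit g 2≤g e 1≤e zero = refl
digitSum-spacedRepunit g 2≤g e@(suc e′) 1≤e (suc s) = begin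
  digitSum g (spacedRepunit g e (suc s))      ≡⟨ cong (digitSum g) (spacedRepunit-suc g e s) ⟩
  digitSum g (1 + g * g ^ e′ * R)             ≡⟨ cong (λ x → digitSum g (1 + x)) (*-assoc g (g ^ e′) R) ⟩
  digitSum g (1 + g * (g ^ e′ * R))           ≡⟨ digitSum-digit+base* g 2≤g 1 (g ^ e′ * R) 2≤g ⟩
  1 + digitSum g (g ^ e′ * R)                 ≡⟨ cong (1 +_) (digitSum-base^* g 2≤g e′ R) ⟩
  1 + digitSum g R                            ≡⟨ cong (1 +_) (digitSum-spacedRepunit g 2≤g e 1≤e s) ⟩
  suc s                                       ∎
  where
  open ≡-Reasoning
  R = spacedRepunit g e s

spacedRepunit-^ : ∀ b k e s → spacedRepunit (b ^ k) e s ≡ spacedRepunit b (k * e) s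
spacedRepunit-^ b k e s = sumRange-cong s λ j →
  trans (^-*-assoc b k (j * e))
        (cong (b ^_) (trans (sym (*-assoc k j e)) (trans (cong (_* e) (*-comm k j)) (*-assoc j k e))))

spacedRepunit-% : ∀ M .{{_ : NonZero M}} g e → g ^ e % M ≡ 1 % M → ∀ s →
                  spacedRepunit g e s % M ≡ s % M
spacedRepunit-% M g e g^e≡1 = sumRange-%-ones M _ λ j →
  trans (cong (_% M) (trans (cong (g ^_) (*-comm j e)) (sym (^-*-assoc g e j))))
        (^-%-one M (g ^ e) g^e≡1 j)

proposition4p1 : (b k m r s ω : ℕ)
    → .{{_ : NonZero b}} .{{_ : NonZero (b ^ k)}} .{{_ : NonZero m}} .{{_ : NonZero (m * s)}}
    → 2 ≤ b → 1 ≤ k → 1 ≤ m → gcd m b ≡ 1 → r < m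
    → 1 ≤ s → s % m ≡ r % m → gcd s b ≡ 1
    → IsOrder (m * s) (b ^ k) ω
    → let n = sumRange s (λ j → (b ^ k) ^ (j * ω)) in
      (n % m ≡ r % m)
      × (digitSum (b ^ k) n ≡ s × digitSum b n ≡ s)
      × (s ∣ n)
      × (Niven b n × Niven (b ^ k) n)
proposition4p1 b k m r s ω 2≤b 1≤k _ _ _ 1≤s s≡r _ (1≤ω , B^ω≡1 , _) =
  n≡r , (digitSumB , digitSumb) , s∣n ,
  subst (_∣ n) (sym digitSumb) s∣n , subst (_∣ n) (sym digitSumB) s∣n
  where
  instance
    s≢0 : NonZero s
    s≢0 = >-nonZero 1≤s
  B = b ^ k
  n = spacedRepunit B ω s
  n≡s : n % (m * s) ≡ s % (m * s)
  n≡s = spacedRepunit-% (m * s) B ω B^ω≡1 s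
  n≡r : n % m ≡ r % m
  n≡r = trans (%-cong-∣ m (m * s) (m∣m*n s) n s n≡s) s≡r
  s∣n : s ∣ n
  s∣n = m%n≡0⇒n∣m n s (trans (%-cong-∣ s (m * s) (n∣m*n m) n s n≡s) (n%n≡0 s))
  2≤B : 2 ≤ B
  2≤B = ≤-trans 2≤b (subst (_≤ B) (*-identityʳ b) (^-monoʳ-≤ b 1≤k))
  digitSumB : digitSum B n ≡ s
  digitSumB = digitSum-spacedRepunit B 2≤B ω 1≤ω s
  digitSumb : digitSum b n ≡ s
  digitSumb = trans (cong (digitSum b) (spacedRepunit-^ b k ω s))
                    (digitSum-spacedRepunit b 2≤b (k * ω) (*-mono-≤ 1≤k 1≤ω) s)
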